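{- Let $(P,\leq,{}',0,1)$ be a bounded pseudocomplemented poset and put $P':=\{x'\mid x\in P\}$. Then $(P',\leq,{}',0,1)$ is a complemented poset; that is, $0,1\in P'$, $a'\in P'$ for every $a\in P'$, and for every $a\in P'$ the only element of $P'$ below both $a$ and $a'$ is $0$ and the only element of $P'$ above both $a$ and $a'$ is $1$.
   Context: A bounded pseudocomplemented poset $(P,\leq,{}',0,1)$ is a poset with bottom element $0$ and top element $1$ together with a unary operation $'$ such that for each $x\in P$, $x'$ is the greatest element $y$ of $P$ with $L(x,y)=\{0\}$, where $L(x,y)=\{z\in P\mid z\leq x,\ z\leq y\}$. -}

module Defs where

open import Level using (Level; _⊔_; suc)
open import Data.Product using (Σ; ∃; _×_; _,_)
open import Relation.Binary.Bundles using (Poset)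

record BPCPoset (c ℓ₁ ℓ₂ : Level) : Set (Level.suc (c ⊔ ℓ₁ ⊔ ℓ₂)) where
  field
    poset : Poset c ℓ₁ ℓ₂
  open Poset poset public
  field
    0# : Carrier
    1# : Carrier
    0-least    : ∀ x → 0# ≤ x
    1-greatest : ∀ x → x ≤ 1#
    _′ : Carrier → Carrier

  -- L(x,y) = {0}: every common lower bound of x and y equals 0
  -- (0 itself always lies in L(x,y) since 0 is the bottom element).
  LIsZero : Carrier → Carrier → Set (c ⊔ ℓ₁ ⊔ ℓ₂)
  LIsZero x y = ∀ z → z ≤ x → z ≤ y → z ≈ 0#

  field
    pc-disjoint : ∀ x → LIsZero x (x ′)
    pc-greatest : ∀ x y → LIsZero x y → y ≤ x ′

  InP′ : Carrier → Set (c ⊔ ℓ₁)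
  InP′ a = ∃ λ x → a ≈ x ′

{-# OPTIONS --safe #-}
module Submission where

-- The pseudocomplement is antitone with x ≤ x′′, so x′′′ = x′ and the elements of P′
-- are exactly the fixed points of ′′. The meet condition holds in all of P
-- because x′ is disjoint from x. For the join condition, if a ≤ z and a′ ≤ z then z′ lies
-- below both a′ and a′′, hence z′ = 0, and a regular z satisfies z = z′′ = 0′ = 1.

open import Defs
open import Level using (Level)
open import Data.Product using (_×_; _,_)

module Pseudocomplement {c ℓ₁ ℓ₂ : Level} (P : BPCPoset c ℓ₁ ℓ₂) where
  open BPCPoset P

  ≤0⇒≈0 : ∀ {x} → x ≤ 0# → x ≈ 0#
  ≤0⇒≈0 {x} x≤0 = antisym x≤0 (0-least x)

  ′-antitone : ∀ {x y} → x ≤ y → y ′ ≤ x ′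
  ′-antitone {x} {y} x≤y =
    pc-greatest x (y ′) (λ z z≤x z≤y′ → pc-disjoint y z (trans z≤x x≤y) z≤y′)

  ′-cong : ∀ {x y} → x ≈ y → x ′ ≈ y ′
  ′-cong x≈y = antisym (′-antitone (reflexive (Eq.sym x≈y))) (′-antitone (reflexive x≈y))

  x≤x′′ : ∀ x → x ≤ (x ′) ′
  x≤x′′ x = pc-greatest (x ′) x (λ z z≤x′ z≤x → pc-disjoint x z z≤x z≤x′)

  x′′′≈x′ : ∀ x → ((x ′) ′) ′ ≈ x ′
  x′′′≈x′ x = antisym (′-antitone (x≤x′′ x)) (x≤x′′ (x ′))

  InP′⇒x′′≈x : ∀ {a} → InP′ a → (a ′) ′ ≈ a
  InP′⇒x′′≈x {a} (x , a≈x′) =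
    Eq.trans (′-cong (′-cong a≈x′)) (Eq.trans (x′′′≈x′ x) (Eq.sym a≈x′))

  0′≈1 : 0# ′ ≈ 1#
  0′≈1 = antisym (1-greatest _) (pc-greatest 0# 1# (λ z z≤0 _ → ≤0⇒≈0 z≤0))

  1′≈0 : 1# ′ ≈ 0#
  1′≈0 = pc-disjoint 1# (1# ′) (1-greatest _) refl

  ′≈0⇒≈1 : ∀ {z} → InP′ z → z ′ ≈ 0# → z ≈ 1#
  ′≈0⇒≈1 z∈P′ z′≈0 =
    Eq.trans (Eq.sym (InP′⇒x′′≈x z∈P′)) (Eq.trans (′-cong z′≈0) 0′≈1)

  x≤z⇒x′≤z⇒z′≈0 : ∀ {x z} → x ≤ z → x ′ ≤ z → z ′ ≈ 0#
  x≤z⇒x′≤z⇒z′≈0 {x} {z} x≤z x′≤z =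
    pc-disjoint (x ′) (z ′) (′-antitone x≤z) (′-antitone x′≤z)

proposition3 : ∀ {c ℓ₁ ℓ₂ : Level} (P : BPCPoset c ℓ₁ ℓ₂) →
    let open BPCPoset P in
      InP′ 0#
      × InP′ 1#
      × (∀ a → InP′ a → InP′ (a ′))
      × (∀ a → InP′ a → ∀ z → InP′ z → z ≤ a → z ≤ a ′ → z ≈ 0#)
      × (∀ a → InP′ a → ∀ z → InP′ z → a ≤ z → a ′ ≤ z → z ≈ 1#)
proposition3 P =
    (1# , Eq.sym 1′≈0)
  , (0# , Eq.sym 0′≈1)
  , (λ a _ → a , Eq.refl)
  , (λ a _ z _ → pc-disjoint a z)
  , (λ a _ z z∈P′ a≤z a′≤z → ′≈0⇒≈1 z∈P′ (x≤z⇒x′≤z⇒z′≈0 a≤z a′≤z))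
  where
  open BPCPoset P
  open Pseudocomplement P
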